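{- Let $M(A)$ and $N(B)$ be matched matroids. Let $M_1=M\oplus I(B-A)$ (the elements of $B-A$ adjoined as isthmuses) and $N_0=N\oplus I^*(A-B)$ (the elements of $A-B$ adjoined as loops), both matroids on $A\cup B$. Let $\mathcal L$ be the set of matroids $L$ on $A\cup B$ with $N_0\unlhd L\unlhd M_1$ and $r(L)-r(N)=r_M(A-B)$. Then the set of all splices of $M$ and $N$ is a filter (an up-set) of $\mathcal L$ with respect to the weak order; in particular every splice lies in $\mathcal L$.
   Context: $M|X$ is restriction; $M.X$ is the contraction of $M$ to $X$, i.e. $M/(E-X)$. Matroids $M(A)$, $N(B)$ are matched if $M.(A\cap B)=N|(A\cap B)$. A splice of $M$ and $N$ is a matroid $L$ on $A\cup B$ with $L|A=M$ and $L.B=N$. $I(X)$ is the free matroid on $X$ and $I^*(X)$ the matroid on $X$ in which every element is a loop. Weak order: $L\le P$ iff independent sets of $L$ are independent in $P$. Strong order: $N\unlhd M$ (on the same ground set) iff every flat of $N$ is a flat of $M$ ($N$ is a quotient of $M$). $r(L)$ is the rank of $L$. -}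

module Defs where

open import Data.Nat using (ℕ; zero; suc; _+_; _<_; _≤_; _⊔_)
open import Data.Bool using (Bool; true; false; _∧_)
open import Data.Fin using (Fin)
open import Data.Fin.Subset using (Subset; inside; outside; _∈_; _∉_; _⊆_; _∪_; _∩_; _─_; ⁅_⁆; ∣_∣; ⊥)
open import Data.Fin.Subset.Properties using (_⊆?_)
open import Data.List using (List; []; _∷_; map; _++_; filterᵇ; foldr)
open import Data.Vec using ([]; _∷_)
open import Data.Product using (Σ; ∃; _×_; _,_)
open import Relation.Nullary.Decidable using (⌊_⌋)
open import Relation.Binary.PropositionalEquality using (_≡_)
open import Function.Bundles using (_⇔_)

allSubsets : (n : ℕ) → List (Subset n)
allSubsets zero = [] ∷ []
allSubsets (suc n) = map (outside ∷_) (allSubsets n) ++ map (inside ∷_) (allSubsets n)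

-- No axioms: used for matroids
-- built from given matroids (restrictions, contractions, direct sums).
record IndepSys (n : ℕ) : Set where
  field
    ground : Subset n
    indep  : Subset n → Bool
open IndepSys public

Indep : ∀ {n} → IndepSys n → Subset n → Set
Indep S I = indep S I ≡ true

record Matroid (n : ℕ) : Set where
  field
    sys          : IndepSys n
    indep⊆ground : ∀ I → Indep sys I → I ⊆ ground sys
    indep-empty  : Indep sys ⊥
    hereditary   : ∀ I J → J ⊆ I → Indep sys I → Indep sys J
    augment      : ∀ I J → Indep sys I → Indep sys J → ∣ I ∣ < ∣ J ∣ →
                   ∃ λ x → x ∈ J × x ∉ I × Indep sys (I ∪ ⁅ x ⁆)
open Matroid public

rank : ∀ {n} → IndepSys n → Subset n → ℕ
rank {n} S X =
  foldr _⊔_ 0 (map ∣_∣ (filterᵇ (λ I → ⌊ I ⊆? X ⌋ ∧ indep S I) (allSubsets n)))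

r : ∀ {n} → IndepSys n → ℕ
r S = rank S (ground S)

_≅_ : ∀ {n} → IndepSys n → IndepSys n → Set
S ≅ S' = (ground S ≡ ground S') × (∀ I → indep S I ≡ indep S' I)

-- Restriction S|X  (X ⊆ ground S in all uses)
_∣ʳ_ : ∀ {n} → IndepSys n → Subset n → IndepSys n
S ∣ʳ X = record { ground = ground S ∩ X ; indep = λ I → indep S I ∧ ⌊ I ⊆? X ⌋ }

-- Contraction S.X = S/(E−X): I is independent iff I ⊆ X ∩ E and
-- r(I ∪ (E−X)) = |I| + r(E−X).
_∙ᶜ_ : ∀ {n} → IndepSys n → Subset n → IndepSys n
S ∙ᶜ X = record
  { ground = ground S ∩ X
  ; indep  = λ I → ⌊ I ⊆? (ground S ∩ X) ⌋
                   ∧ ⌊ rank S (I ∪ (ground S ─ X)) Data.Nat.≟ (∣ I ∣ + rank S (ground S ─ X)) ⌋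
  }

_⊕isthmuses_ : ∀ {n} → IndepSys n → Subset n → IndepSys n
S ⊕isthmuses Y = record
  { ground = ground S ∪ Y
  ; indep  = λ I → indep S (I ∩ ground S) ∧ ⌊ I ⊆? (ground S ∪ Y) ⌋ }

_⊕loops_ : ∀ {n} → IndepSys n → Subset n → IndepSys n
S ⊕loops Y = record
  { ground = ground S ∪ Y
  ; indep  = λ I → indep S I ∧ ⌊ I ⊆? ground S ⌋ }

IsFlat : ∀ {n} → IndepSys n → Subset n → Set
IsFlat S F = F ⊆ ground S × (∀ e → e ∈ ground S → e ∉ F → rank S F < rank S (F ∪ ⁅ e ⁆))

_⊴_ : ∀ {n} → IndepSys n → IndepSys n → Set
N ⊴ M = (ground N ≡ ground M) × (∀ F → IsFlat N F → IsFlat M F)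

_≤w_ : ∀ {n} → IndepSys n → IndepSys n → Set
L ≤w P = ∀ I → Indep L I → Indep P I

Matched : ∀ {n} → IndepSys n → IndepSys n → Set
Matched M N = (M ∙ᶜ (ground M ∩ ground N)) ≅ (N ∣ʳ (ground M ∩ ground N))

IsSplice : ∀ {n} → IndepSys n → IndepSys n → IndepSys n → Set
IsSplice M N L =
  (ground L ≡ ground M ∪ ground N) × ((L ∣ʳ ground M) ≅ M) × ((L ∙ᶜ ground N) ≅ N)

InCalL : ∀ {n} → IndepSys n → IndepSys n → IndepSys n → Set
InCalL M N L =
  let A = ground M ; B = ground N
      M₁ = M ⊕isthmuses (B ─ A)
      N₀ = N ⊕loops (A ─ B)
  in (ground L ≡ A ∪ B) × (N₀ ⊴ L) × (L ⊴ M₁) × (r L ≡ r N + rank M (A ─ B))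

module Submission where

-- For a splice L the two defining conditions fix its rank function where it matters:
-- ρ_L = ρ_M on subsets of A, and ρ_L(X ∪ (A − B)) = ρ_N(X) + ρ_M(A − B).  This gives r(L),
-- shows that every flat of N₀ (which must contain the loops A − B) is a flat of L, and, since
-- ρ_{M₁}(X) = ρ_M(X ∩ A) + |X − A|, that every flat of L is a flat of M₁.
-- Conversely, a quotient Q ⊴ R satisfies ρ_Q(Y) − ρ_Q(X) ≤ ρ_R(Y) − ρ_R(X) for X ⊆ Y, because
-- the Q-closure of X is a flat of R; in particular Q ≤ R in the weak order.  If P ∈ 𝓛 lies above
-- a splice L, then P ≤ M₁ and L ≤ P force P|A = M, L ≤ P makes every N-independent set independent
-- in P.B, and the inequality for N₀ ⊴ P together with r(P) = r(N) + r_M(A − B) gives |I| ≤ ρ_N(I)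
-- for every I independent in P.B.

open import Defs
open import Data.Nat using (ℕ; zero; suc; _+_; _<_; _≤_; _⊔_; z≤n; _≤?_; _<?_; _≟_)
open import Data.Nat.Properties
open import Data.Bool using (Bool; true; false; _∧_)
open import Data.Fin as Fin using (Fin)
open import Data.Fin.Subset
  using (Subset; inside; outside; _∈_; _∉_; _⊆_; _∪_; _∩_; _─_; _-_; ⁅_⁆; ∣_∣; ⊥; Empty; Nonempty)
open import Data.Fin.Subset.Properties
open import Data.List using ([]; _∷_; map; _++_; filterᵇ; foldr)
import Data.List.Membership.Propositional as List
open import Data.List.Membership.Propositional.Properties using (∈-++⁺ˡ; ∈-++⁺ʳ; ∈-map⁺)
open import Data.List.Relation.Unary.Any using (here; there)
open import Data.Vec using ([]; _∷_; here; there; tabulate)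
open import Data.Vec.Properties using ([]=⇒lookup; lookup⇒[]=; lookup∘tabulate)
open import Data.Nat.Tactic.RingSolver using (solve-∀)
open import Data.Product using (∃; _×_; _,_; proj₁; proj₂)
open import Data.Sum using (_⊎_; inj₁; inj₂)
open import Relation.Nullary using (Dec; yes; no; ¬_; contradiction)
open import Relation.Nullary.Decidable using (⌊_⌋)
open import Relation.Binary.PropositionalEquality
open import Function using (_∘_)

⌊⌋-true⁻ : ∀ {p} {P : Set p} (P? : Dec P) → ⌊ P? ⌋ ≡ true → P
⌊⌋-true⁻ (yes p) _  = p
⌊⌋-true⁻ (no _)  ()

⌊⌋-true⁺ : ∀ {p} {P : Set p} (P? : Dec P) → P → ⌊ P? ⌋ ≡ true
⌊⌋-true⁺ (yes _) _ = refl
⌊⌋-true⁺ (no ¬p) p = contradiction p ¬p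

∧-true⁻ : ∀ {a b} → a ∧ b ≡ true → a ≡ true × b ≡ true
∧-true⁻ {true} {true} _ = refl , refl

∧-true⁺ : ∀ {a b} → a ≡ true → b ≡ true → a ∧ b ≡ true
∧-true⁺ refl refl = refl

≡true-ext : ∀ {a b} → (a ≡ true → b ≡ true) → (b ≡ true → a ≡ true) → a ≡ b
≡true-ext {true}  {true}  _ _ = refl
≡true-ext {true}  {false} f _ = sym (f refl)
≡true-ext {false} {true}  _ g = g refl
≡true-ext {false} {false} _ _ = refl

-- Finite subsets

x∈p─q⇒x∉q : ∀ {n} (p q : Subset n) {x} → x ∈ p ─ q → x ∉ q
x∈p─q⇒x∉q (inside ∷ p) (outside ∷ q) here ()
x∈p─q⇒x∉q (_ ∷ p) (_ ∷ q) (there x∈p─q) (there x∈q) = x∈p─q⇒x∉q p q x∈p─q x∈q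

module _ {n : ℕ} where

  x∈p─q⁻ : ∀ (p q : Subset n) {x} → x ∈ p ─ q → x ∈ p × x ∉ q
  x∈p─q⁻ p q x∈p─q = p─q⊆p p q x∈p─q , x∈p─q⇒x∉q p q x∈p─q

  ∪-least : ∀ {p q r : Subset n} → p ⊆ r → q ⊆ r → p ∪ q ⊆ r
  ∪-least {p} {q} p⊆r q⊆r x∈p∪q with x∈p∪q⁻ p q x∈p∪q
  ... | inj₁ x∈p = p⊆r x∈p
  ... | inj₂ x∈q = q⊆r x∈q

  ∩-greatest : ∀ {p q r : Subset n} → r ⊆ p → r ⊆ q → r ⊆ p ∩ q
  ∩-greatest r⊆p r⊆q x∈r = x∈p∩q⁺ (r⊆p x∈r , r⊆q x∈r)

  x∈p⇒⁅x⁆⊆p : ∀ {x} {p : Subset n} → x ∈ p → ⁅ x ⁆ ⊆ p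
  x∈p⇒⁅x⁆⊆p {x} x∈p y∈⁅x⁆ rewrite x∈⁅y⁆⇒x≡y x y∈⁅x⁆ = x∈p

  ∪-monoˡ-⊆ : ∀ {p q : Subset n} (r : Subset n) → p ⊆ q → p ∪ r ⊆ q ∪ r
  ∪-monoˡ-⊆ {q = q} r p⊆q = ∪-least (λ x∈p → p⊆p∪q r (p⊆q x∈p)) (q⊆p∪q q r)

  ∩-monoˡ-⊆ : ∀ {p q : Subset n} (r : Subset n) → p ⊆ q → p ∩ r ⊆ q ∩ r
  ∩-monoˡ-⊆ {p} r p⊆q x∈ = let x∈p , x∈r = x∈p∩q⁻ p r x∈ in x∈p∩q⁺ (p⊆q x∈p , x∈r)

  ─-monoˡ-⊆ : ∀ {p q : Subset n} (r : Subset n) → p ⊆ q → p ─ r ⊆ q ─ r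
  ─-monoˡ-⊆ {p} r p⊆q x∈ = let x∈p , x∉r = x∈p─q⁻ p r x∈ in x∈p∧x∉q⇒x∈p─q (p⊆q x∈p) x∉r

  x∈p⇒p∪⁅x⁆≡p : ∀ {x} (p : Subset n) → x ∈ p → p ∪ ⁅ x ⁆ ≡ p
  x∈p⇒p∪⁅x⁆≡p p x∈p = ⊆-antisym (∪-least ⊆-refl (x∈p⇒⁅x⁆⊆p x∈p)) (p⊆p∪q _)

  p⊆q∧∣q∣≤∣p∣⇒p≡q : ∀ {p q : Subset n} → p ⊆ q → ∣ q ∣ ≤ ∣ p ∣ → p ≡ q
  p⊆q∧∣q∣≤∣p∣⇒p≡q {p} {q} p⊆q ∣q∣≤∣p∣ = ⊆-antisym p⊆q q⊆p
    where
    q⊆p : q ⊆ p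
    q⊆p {x} x∈q with x ∈? p
    ... | yes x∈p = x∈p
    ... | no  x∉p = contradiction (p⊂q⇒∣p∣<∣q∣ (p⊆q , x , x∈q , x∉p)) (≤⇒≯ ∣q∣≤∣p∣)

  ¬Nonempty[p─q]⇒p⊆q : ∀ {p q : Subset n} → ¬ Nonempty (p ─ q) → p ⊆ q
  ¬Nonempty[p─q]⇒p⊆q {p} {q} p─q-empty {x} x∈p with x ∈? q
  ... | yes x∈q = x∈q
  ... | no  x∉q = contradiction (x , x∈p∧x∉q⇒x∈p─q x∈p x∉q) p─q-empty

  ∣p∣<∣q∣⇒∃∈q─p : ∀ {p q : Subset n} → ∣ p ∣ < ∣ q ∣ → ∃ λ x → x ∈ q × x ∉ p
  ∣p∣<∣q∣⇒∃∈q─p {p} {q} ∣p∣<∣q∣ with nonempty? (q ─ p)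
  ... | yes (x , x∈q─p) = x , x∈p─q⁻ q p x∈q─p
  ... | no  q─p-empty   = contradiction (p⊆q⇒∣p∣≤∣q∣ (¬Nonempty[p─q]⇒p⊆q q─p-empty)) (<⇒≱ ∣p∣<∣q∣)

∣p∣≡∣p∩q∣+∣p─q∣ : ∀ {n} (p q : Subset n) → ∣ p ∣ ≡ ∣ p ∩ q ∣ + ∣ p ─ q ∣
∣p∣≡∣p∩q∣+∣p─q∣ []            []            = refl
∣p∣≡∣p∩q∣+∣p─q∣ (outside ∷ p) (outside ∷ q) = ∣p∣≡∣p∩q∣+∣p─q∣ p q
∣p∣≡∣p∩q∣+∣p─q∣ (outside ∷ p) (inside ∷ q)  = ∣p∣≡∣p∩q∣+∣p─q∣ p q
∣p∣≡∣p∩q∣+∣p─q∣ (inside ∷ p)  (inside ∷ q)  = cong suc (∣p∣≡∣p∩q∣+∣p─q∣ p q)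
∣p∣≡∣p∩q∣+∣p─q∣ (inside ∷ p)  (outside ∷ q) =
  trans (cong suc (∣p∣≡∣p∩q∣+∣p─q∣ p q)) (sym (+-suc _ _))

∣p∪q∣+∣p∩q∣≡∣p∣+∣q∣ : ∀ {n} (p q : Subset n) → ∣ p ∪ q ∣ + ∣ p ∩ q ∣ ≡ ∣ p ∣ + ∣ q ∣
∣p∪q∣+∣p∩q∣≡∣p∣+∣q∣ []            []            = refl
∣p∪q∣+∣p∩q∣≡∣p∣+∣q∣ (outside ∷ p) (outside ∷ q) = ∣p∪q∣+∣p∩q∣≡∣p∣+∣q∣ p q
∣p∪q∣+∣p∩q∣≡∣p∣+∣q∣ (outside ∷ p) (inside ∷ q)  =
  trans (cong suc (∣p∪q∣+∣p∩q∣≡∣p∣+∣q∣ p q)) (sym (+-suc _ _))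
∣p∪q∣+∣p∩q∣≡∣p∣+∣q∣ (inside ∷ p)  (outside ∷ q) = cong suc (∣p∪q∣+∣p∩q∣≡∣p∣+∣q∣ p q)
∣p∪q∣+∣p∩q∣≡∣p∣+∣q∣ (inside ∷ p)  (inside ∷ q)  =
  cong suc (trans (+-suc _ _) (trans (cong suc (∣p∪q∣+∣p∩q∣≡∣p∣+∣q∣ p q)) (sym (+-suc _ _))))

Empty[p∩q]⇒∣p∪q∣≡∣p∣+∣q∣ : ∀ {n} (p q : Subset n) → Empty (p ∩ q) → ∣ p ∪ q ∣ ≡ ∣ p ∣ + ∣ q ∣
Empty[p∩q]⇒∣p∪q∣≡∣p∣+∣q∣ {n} p q p∩q-empty = begin
  ∣ p ∪ q ∣                ≡⟨ sym (+-identityʳ _) ⟩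
  ∣ p ∪ q ∣ + 0            ≡⟨ cong (∣ p ∪ q ∣ +_) (sym (∣⊥∣≡0 n)) ⟩
  ∣ p ∪ q ∣ + ∣ ⊥ {n} ∣    ≡⟨ cong (λ s → ∣ p ∪ q ∣ + ∣ s ∣) (sym (Empty-unique p∩q-empty)) ⟩
  ∣ p ∪ q ∣ + ∣ p ∩ q ∣    ≡⟨ ∣p∪q∣+∣p∩q∣≡∣p∣+∣q∣ p q ⟩
  ∣ p ∣ + ∣ q ∣            ∎
  where open ≡-Reasoning

∣p─r∣<∣q─r∣ : ∀ {n} (p q r : Subset n) → ∣ p ∣ < ∣ q ∣ → ∣ q ∩ r ∣ ≤ ∣ p ∩ r ∣ → ∣ p ─ r ∣ < ∣ q ─ r ∣
∣p─r∣<∣q─r∣ p q r ∣p∣<∣q∣ ∣q∩r∣≤∣p∩r∣ = +-cancelˡ-< ∣ q ∩ r ∣ _ _ (begin-strict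
  ∣ q ∩ r ∣ + ∣ p ─ r ∣   ≤⟨ +-monoˡ-≤ _ ∣q∩r∣≤∣p∩r∣ ⟩
  ∣ p ∩ r ∣ + ∣ p ─ r ∣   ≡⟨ sym (∣p∣≡∣p∩q∣+∣p─q∣ p r) ⟩
  ∣ p ∣                   <⟨ ∣p∣<∣q∣ ⟩
  ∣ q ∣                   ≡⟨ ∣p∣≡∣p∩q∣+∣p─q∣ q r ⟩
  ∣ q ∩ r ∣ + ∣ q ─ r ∣   ∎)
  where open ≤-Reasoning

x∉p⇒∣p∪⁅x⁆∣≡1+∣p∣ : ∀ {n} (p : Subset n) {x} → x ∉ p → ∣ p ∪ ⁅ x ⁆ ∣ ≡ suc ∣ p ∣
x∉p⇒∣p∪⁅x⁆∣≡1+∣p∣ (outside ∷ p) {Fin.zero}  _   = cong suc (cong ∣_∣ (∪-identityʳ p))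
x∉p⇒∣p∪⁅x⁆∣≡1+∣p∣ (inside ∷ p)  {Fin.zero}  x∉p = contradiction here x∉p
x∉p⇒∣p∪⁅x⁆∣≡1+∣p∣ (outside ∷ p) {Fin.suc x} x∉p = x∉p⇒∣p∪⁅x⁆∣≡1+∣p∣ p (x∉p ∘ there)
x∉p⇒∣p∪⁅x⁆∣≡1+∣p∣ (inside ∷ p)  {Fin.suc x} x∉p = cong suc (x∉p⇒∣p∪⁅x⁆∣≡1+∣p∣ p (x∉p ∘ there))

q∪[p─q]≡p∪q : ∀ {n} (p q : Subset n) → q ∪ (p ─ q) ≡ p ∪ q
q∪[p─q]≡p∪q []            []            = refl
q∪[p─q]≡p∪q (outside ∷ p) (outside ∷ q) = cong (outside ∷_) (q∪[p─q]≡p∪q p q)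
q∪[p─q]≡p∪q (inside ∷ p)  (outside ∷ q) = cong (inside ∷_) (q∪[p─q]≡p∪q p q)
q∪[p─q]≡p∪q (outside ∷ p) (inside ∷ q)  = cong (inside ∷_) (q∪[p─q]≡p∪q p q)
q∪[p─q]≡p∪q (inside ∷ p)  (inside ∷ q)  = cong (inside ∷_) (q∪[p─q]≡p∪q p q)

[p∪q]─q≡p─q : ∀ {n} (p q : Subset n) → (p ∪ q) ─ q ≡ p ─ q
[p∪q]─q≡p─q []            []            = refl
[p∪q]─q≡p─q (_ ∷ p)       (inside ∷ q)  = cong (outside ∷_) ([p∪q]─q≡p─q p q)
[p∪q]─q≡p─q (outside ∷ p) (outside ∷ q) = cong (outside ∷_) ([p∪q]─q≡p─q p q)
[p∪q]─q≡p─q (inside ∷ p)  (outside ∷ q) = cong (inside ∷_) ([p∪q]─q≡p─q p q)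

-- Rank

module _ {a} {A : Set a} (f : A → ℕ) (P : A → Bool) where

  f≤max-filter : ∀ {xs x} → x List.∈ xs → P x ≡ true → f x ≤ foldr _⊔_ 0 (map f (filterᵇ P xs))
  f≤max-filter {x ∷ _}  (here refl) Px rewrite Px = m≤m⊔n _ _
  f≤max-filter {y ∷ xs} (there x∈xs) Px with P y
  ... | true  = ≤-trans (f≤max-filter x∈xs Px) (m≤n⊔m _ _)
  ... | false = f≤max-filter x∈xs Px

  max-filter-attained : ∀ xs → let m = foldr _⊔_ 0 (map f (filterᵇ P xs)) in
                        m ≡ 0 ⊎ ∃ λ x → P x ≡ true × f x ≡ m
  max-filter-attained [] = inj₁ refl
  max-filter-attained (x ∷ xs) with P x in Px
  ... | false = max-filter-attained xs
  ... | true with ⊔-sel (f x) (foldr _⊔_ 0 (map f (filterᵇ P xs)))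
  ...   | inj₁ eq = inj₂ (x , Px , sym eq)
  ...   | inj₂ eq with max-filter-attained xs
  ...     | inj₁ m≡0            = inj₁ (trans eq m≡0)
  ...     | inj₂ (y , Py , fy≡m) = inj₂ (y , Py , trans fy≡m (sym eq))

∈-allSubsets : ∀ {n} (I : Subset n) → I List.∈ allSubsets n
∈-allSubsets []                    = here refl
∈-allSubsets {suc n} (outside ∷ I) = ∈-++⁺ˡ (∈-map⁺ (outside ∷_) (∈-allSubsets I))
∈-allSubsets {suc n} (inside ∷ I)  =
  ∈-++⁺ʳ (map (outside ∷_) (allSubsets n)) (∈-map⁺ (inside ∷_) (∈-allSubsets I))

module _ {n : ℕ} where

  indep⇒∣∣≤rank : (S : IndepSys n) {I X : Subset n} → Indep S I → I ⊆ X → ∣ I ∣ ≤ rank S X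
  indep⇒∣∣≤rank S {I} {X} I-indep I⊆X =
    f≤max-filter ∣_∣ _ (∈-allSubsets I) (∧-true⁺ (⌊⌋-true⁺ (I ⊆? X) I⊆X) I-indep)

  rank≡0⊎attained : (S : IndepSys n) (X : Subset n) →
                    rank S X ≡ 0 ⊎ ∃ λ I → I ⊆ X × Indep S I × ∣ I ∣ ≡ rank S X
  rank≡0⊎attained S X with max-filter-attained ∣_∣ (λ I → ⌊ I ⊆? X ⌋ ∧ indep S I) (allSubsets n)
  ... | inj₁ rank≡0 = inj₁ rank≡0
  ... | inj₂ (I , PI , ∣I∣≡rank) =
        inj₂ (I , ⌊⌋-true⁻ (I ⊆? X) (proj₁ (∧-true⁻ PI)) , proj₂ (∧-true⁻ PI) , ∣I∣≡rank)

  rank-≤-by-indep : (S T : IndepSys n) {X Y : Subset n} →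
                    (∀ I → Indep S I → I ⊆ X → Indep T I × I ⊆ Y) → rank S X ≤ rank T Y
  rank-≤-by-indep S T {X} transfer with rank≡0⊎attained S X
  ... | inj₁ rank≡0 rewrite rank≡0 = z≤n
  ... | inj₂ (I , I⊆X , I-indep , ∣I∣≡rank) =
        subst (_≤ _) ∣I∣≡rank (indep⇒∣∣≤rank T (proj₁ (transfer I I-indep I⊆X)) (proj₂ (transfer I I-indep I⊆X)))

  rank-mono : (S : IndepSys n) {X Y : Subset n} → X ⊆ Y → rank S X ≤ rank S Y
  rank-mono S X⊆Y = rank-≤-by-indep S S (λ I I-indep I⊆X → I-indep , ⊆-trans I⊆X X⊆Y)

  rank-mono-≤w : {S T : IndepSys n} → S ≤w T → (X : Subset n) → rank S X ≤ rank T X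
  rank-mono-≤w {S} {T} S≤T X = rank-≤-by-indep S T (λ I I-indep I⊆X → S≤T I I-indep , I⊆X)

  indep-cong⇒rank≡ : {S T : IndepSys n} → (∀ I → indep S I ≡ indep T I) → (X : Subset n) →
                      rank S X ≡ rank T X
  indep-cong⇒rank≡ {S} {T} S≗T X = ≤-antisym
    (rank-mono-≤w {S} {T} (λ I → subst (_≡ true) (S≗T I)) X)
    (rank-mono-≤w {T} {S} (λ I → subst (_≡ true) (sym (S≗T I))) X)

  ≅⇒rank≡ : {S T : IndepSys n} → S ≅ T → (X : Subset n) → rank S X ≡ rank T X
  ≅⇒rank≡ {S} {T} S≅T = indep-cong⇒rank≡ {S} {T} (proj₂ S≅T)

  rank≤∣∣ : (S : IndepSys n) (X : Subset n) → rank S X ≤ ∣ X ∣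
  rank≤∣∣ S X with rank≡0⊎attained S X
  ... | inj₁ rank≡0 rewrite rank≡0 = z≤n
  ... | inj₂ (I , I⊆X , _ , ∣I∣≡rank) = subst (_≤ ∣ X ∣) ∣I∣≡rank (p⊆q⇒∣p∣≤∣q∣ I⊆X)

  rank-∣ʳ : (S : IndepSys n) {X Y : Subset n} → X ⊆ Y → rank (S ∣ʳ Y) X ≡ rank S X
  rank-∣ʳ S {X} {Y} X⊆Y = ≤-antisym
    (rank-≤-by-indep (S ∣ʳ Y) S λ I I-indep I⊆X → proj₁ (∧-true⁻ I-indep) , I⊆X)
    (rank-≤-by-indep S (S ∣ʳ Y) λ I I-indep I⊆X → ∧-true⁺ I-indep (⌊⌋-true⁺ (I ⊆? Y) (⊆-trans I⊆X X⊆Y)) , I⊆X)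

module _ {n : ℕ} (S : Matroid n) where

  private
    ρ : Subset n → ℕ
    ρ = rank (sys S)

  rank-basis : (X : Subset n) → ∃ λ I → I ⊆ X × Indep (sys S) I × ∣ I ∣ ≡ ρ X
  rank-basis X with rank≡0⊎attained (sys S) X
  ... | inj₂ basis  = basis
  ... | inj₁ rank≡0 = ⊥ , ⊆-min X , indep-empty S , trans (∣⊥∣≡0 n) (sym rank≡0)

  ∣∣≤rank⇒indep : {I : Subset n} → ∣ I ∣ ≤ ρ I → Indep (sys S) I
  ∣∣≤rank⇒indep {I} ∣I∣≤ρI with rank-basis I
  ... | J , J⊆I , J-indep , ∣J∣≡ρI =
        subst (Indep (sys S)) (p⊆q∧∣q∣≤∣p∣⇒p≡q J⊆I (subst (∣ I ∣ ≤_) (sym ∣J∣≡ρI) ∣I∣≤ρI)) J-indep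

  basis-extension : {I X : Subset n} → Indep (sys S) I → I ⊆ X →
                    ∃ λ J → I ⊆ J × J ⊆ X × Indep (sys S) J × ∣ J ∣ ≡ ρ X
  basis-extension {I₀} {X} I₀-indep I₀⊆X = extend (ρ X) I₀-indep I₀⊆X (m≤m+n _ _)
    where
    extend : (k : ℕ) {I : Subset n} → Indep (sys S) I → I ⊆ X → ρ X ≤ k + ∣ I ∣ →
             ∃ λ J → I ⊆ J × J ⊆ X × Indep (sys S) J × ∣ J ∣ ≡ ρ X
    extend k {I} I-indep I⊆X bound with ρ X ≤? ∣ I ∣
    ... | yes ρX≤∣I∣ = I , ⊆-refl , I⊆X , I-indep , ≤-antisym (indep⇒∣∣≤rank (sys S) I-indep I⊆X) ρX≤∣I∣
    extend zero    I-indep I⊆X bound | no ρX≰∣I∣ = contradiction bound ρX≰∣I∣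
    extend (suc k) {I} I-indep I⊆X bound | no ρX≰∣I∣
      with K , K⊆X , K-indep , ∣K∣≡ρX ← rank-basis X
      with x , x∈K , x∉I , I+x-indep ← augment S I K I-indep K-indep (subst (∣ I ∣ <_) (sym ∣K∣≡ρX) (≰⇒> ρX≰∣I∣))
      with J , I+x⊆J , J⊆X , J-indep , ∣J∣≡ρX ← extend k I+x-indep (∪-least I⊆X (x∈p⇒⁅x⁆⊆p (K⊆X x∈K)))
             (subst (ρ X ≤_) (trans (sym (+-suc k ∣ I ∣)) (cong (k +_) (sym (x∉p⇒∣p∪⁅x⁆∣≡1+∣p∣ I x∉I)))) bound)
      = J , ⊆-trans (p⊆p∪q ⁅ x ⁆) I+x⊆J , J⊆X , J-indep , ∣J∣≡ρX

  rank-submodular : (X Y : Subset n) → ρ (X ∪ Y) + ρ (X ∩ Y) ≤ ρ X + ρ Y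
  rank-submodular X Y
    with I , I⊆X∩Y , I-indep , ∣I∣≡ρX∩Y ← rank-basis (X ∩ Y)
    with J , I⊆J , J⊆X∪Y , J-indep , ∣J∣≡ρX∪Y ← basis-extension I-indep (⊆-trans I⊆X∩Y (⊆-trans (p∩q⊆p X Y) (p⊆p∪q Y)))
    = begin
      ρ (X ∪ Y) + ρ (X ∩ Y)                       ≡⟨ cong₂ _+_ (sym ∣J∣≡ρX∪Y) (sym ∣I∣≡ρX∩Y) ⟩
      ∣ J ∣ + ∣ I ∣                                ≤⟨ +-mono-≤ (p⊆q⇒∣p∣≤∣q∣ J⊆JX∪JY) (p⊆q⇒∣p∣≤∣q∣ I⊆JX∩JY) ⟩
      ∣ J ∩ X ∪ J ∩ Y ∣ + ∣ (J ∩ X) ∩ (J ∩ Y) ∣    ≡⟨ ∣p∪q∣+∣p∩q∣≡∣p∣+∣q∣ (J ∩ X) (J ∩ Y) ⟩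
      ∣ J ∩ X ∣ + ∣ J ∩ Y ∣                        ≤⟨ +-mono-≤ (independent-part X) (independent-part Y) ⟩
      ρ X + ρ Y                                   ∎
    where
    open ≤-Reasoning
    J⊆JX∪JY : J ⊆ J ∩ X ∪ J ∩ Y
    J⊆JX∪JY x∈J with x∈p∪q⁻ X Y (J⊆X∪Y x∈J)
    ... | inj₁ x∈X = p⊆p∪q (J ∩ Y) (x∈p∩q⁺ (x∈J , x∈X))
    ... | inj₂ x∈Y = q⊆p∪q (J ∩ X) (J ∩ Y) (x∈p∩q⁺ (x∈J , x∈Y))
    I⊆JX∩JY : I ⊆ (J ∩ X) ∩ (J ∩ Y)
    I⊆JX∩JY x∈I = let x∈X , x∈Y = x∈p∩q⁻ X Y (I⊆X∩Y x∈I) in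
                  x∈p∩q⁺ (x∈p∩q⁺ (I⊆J x∈I , x∈X) , x∈p∩q⁺ (I⊆J x∈I , x∈Y))
    independent-part : (Z : Subset n) → ∣ J ∩ Z ∣ ≤ ρ Z
    independent-part Z = indep⇒∣∣≤rank (sys S) (hereditary S J (J ∩ Z) (p∩q⊆p J Z) J-indep) (p∩q⊆q J Z)

  rank-∪-≤ : (Y Z : Subset n) → ρ (Y ∪ Z) ≤ ∣ Y ∣ + ρ Z
  rank-∪-≤ Y Z = begin
    ρ (Y ∪ Z)                ≤⟨ m≤m+n _ _ ⟩
    ρ (Y ∪ Z) + ρ (Y ∩ Z)    ≤⟨ rank-submodular Y Z ⟩
    ρ Y + ρ Z                ≤⟨ +-monoˡ-≤ (ρ Z) (rank≤∣∣ (sys S) Y) ⟩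
    ∣ Y ∣ + ρ Z              ∎
    where open ≤-Reasoning

  rank-∪⁅⁆≤1+rank : (X : Subset n) (e : Fin n) → ρ (X ∪ ⁅ e ⁆) ≤ suc (ρ X)
  rank-∪⁅⁆≤1+rank X e = begin
    ρ (X ∪ ⁅ e ⁆)    ≡⟨ cong ρ (∪-comm X ⁅ e ⁆) ⟩
    ρ (⁅ e ⁆ ∪ X)    ≤⟨ rank-∪-≤ ⁅ e ⁆ X ⟩
    ∣ ⁅ e ⁆ ∣ + ρ X  ≡⟨ cong (_+ ρ X) (∣⁅x⁆∣≡1 e) ⟩
    suc (ρ X)        ∎
    where open ≤-Reasoning

  rank-increase-antitone : {X Y : Subset n} (e : Fin n) → X ⊆ Y → e ∉ Y →
                           ρ Y < ρ (Y ∪ ⁅ e ⁆) → ρ X < ρ (X ∪ ⁅ e ⁆)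
  rank-increase-antitone {X} {Y} e X⊆Y e∉Y ρY<ρY+e = +-cancelˡ-< (ρ Y) _ _ (begin-strict
    ρ Y + ρ X                                   <⟨ +-monoˡ-< (ρ X) ρY<ρY+e ⟩
    ρ (Y ∪ ⁅ e ⁆) + ρ X                         ≡⟨ cong₂ _+_ (cong ρ Y+e≡X+e∪Y) (cong ρ X≡X+e∩Y) ⟩
    ρ ((X ∪ ⁅ e ⁆) ∪ Y) + ρ ((X ∪ ⁅ e ⁆) ∩ Y)   ≤⟨ rank-submodular (X ∪ ⁅ e ⁆) Y ⟩
    ρ (X ∪ ⁅ e ⁆) + ρ Y                         ≡⟨ +-comm _ (ρ Y) ⟩
    ρ Y + ρ (X ∪ ⁅ e ⁆)                         ∎)
    where
    open ≤-Reasoning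
    Y+e≡X+e∪Y : Y ∪ ⁅ e ⁆ ≡ (X ∪ ⁅ e ⁆) ∪ Y
    Y+e≡X+e∪Y = ⊆-antisym
      (∪-least (q⊆p∪q (X ∪ ⁅ e ⁆) Y) (⊆-trans (q⊆p∪q X ⁅ e ⁆) (p⊆p∪q Y)))
      (∪-least (∪-monoˡ-⊆ ⁅ e ⁆ X⊆Y) (p⊆p∪q ⁅ e ⁆))
    X≡X+e∩Y : X ≡ (X ∪ ⁅ e ⁆) ∩ Y
    X≡X+e∩Y = ⊆-antisym (∩-greatest (p⊆p∪q ⁅ e ⁆) X⊆Y) X+e∩Y⊆X
      where
      X+e∩Y⊆X : (X ∪ ⁅ e ⁆) ∩ Y ⊆ X
      X+e∩Y⊆X x∈ with x∈X+e , x∈Y ← x∈p∩q⁻ (X ∪ ⁅ e ⁆) Y x∈ | x∈p∪q⁻ X ⁅ e ⁆ x∈X+e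
      ... | inj₁ x∈X = x∈X
      ... | inj₂ x∈⁅e⁆ rewrite x∈⁅y⁆⇒x≡y e x∈⁅e⁆ = contradiction x∈Y e∉Y

  rank-∪-outside : (X Z : Subset n) → (∀ {x} → x ∈ Z → x ∉ ground (sys S)) → ρ (X ∪ Z) ≡ ρ X
  rank-∪-outside X Z Z-outside = ≤-antisym (rank-≤-by-indep (sys S) (sys S) stays-in-X) (rank-mono (sys S) (p⊆p∪q Z))
    where
    stays-in-X : ∀ I → Indep (sys S) I → I ⊆ X ∪ Z → Indep (sys S) I × I ⊆ X
    stays-in-X I I-indep I⊆X∪Z = I-indep , I⊆X
      where
      I⊆X : I ⊆ X
      I⊆X x∈I with x∈p∪q⁻ X Z (I⊆X∪Z x∈I)
      ... | inj₁ x∈X = x∈X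
      ... | inj₂ x∈Z = contradiction (indep⊆ground S I I-indep x∈I) (Z-outside x∈Z)

-- Contraction

module _ {n : ℕ} (S : Matroid n) (B : Subset n) where

  private
    E D : Subset n
    E = ground (sys S)
    D = E ─ B
    ρ : Subset n → ℕ
    ρ = rank (sys S)

  indep-∙ᶜ⁻ : {I : Subset n} → Indep (sys S ∙ᶜ B) I → I ⊆ E ∩ B × ρ (I ∪ D) ≡ ∣ I ∣ + ρ D
  indep-∙ᶜ⁻ {I} I-indep = let I⊆E∩B? , rank-eq? = ∧-true⁻ I-indep in
    ⌊⌋-true⁻ (I ⊆? E ∩ B) I⊆E∩B? , ⌊⌋-true⁻ (ρ (I ∪ D) ≟ ∣ I ∣ + ρ D) rank-eq?

  indep-∙ᶜ⁺ : {I : Subset n} → I ⊆ E ∩ B → ∣ I ∣ + ρ D ≤ ρ (I ∪ D) → Indep (sys S ∙ᶜ B) I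
  indep-∙ᶜ⁺ {I} I⊆E∩B ∣I∣+ρD≤ = ∧-true⁺ (⌊⌋-true⁺ (I ⊆? E ∩ B) I⊆E∩B)
    (⌊⌋-true⁺ (ρ (I ∪ D) ≟ ∣ I ∣ + ρ D) (≤-antisym (rank-∪-≤ S I D) ∣I∣+ρD≤))

  rank-∙ᶜ : (X : Subset n) → rank (sys S ∙ᶜ B) X + ρ D ≡ ρ (X ∪ D)
  rank-∙ᶜ X = ≤-antisym lower upper
    where
    open ≤-Reasoning
    lower : rank (sys S ∙ᶜ B) X + ρ D ≤ ρ (X ∪ D)
    lower with rank≡0⊎attained (sys S ∙ᶜ B) X
    ... | inj₁ rank≡0 rewrite rank≡0 = rank-mono (sys S) (q⊆p∪q X D)
    ... | inj₂ (J , J⊆X , J-indep , ∣J∣≡rank) = begin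
      rank (sys S ∙ᶜ B) X + ρ D   ≡⟨ cong (_+ ρ D) (sym ∣J∣≡rank) ⟩
      ∣ J ∣ + ρ D                 ≡⟨ sym (proj₂ (indep-∙ᶜ⁻ J-indep)) ⟩
      ρ (J ∪ D)                   ≤⟨ rank-mono (sys S) (∪-least (⊆-trans J⊆X (p⊆p∪q D)) (q⊆p∪q X D)) ⟩
      ρ (X ∪ D)                   ∎
    -- Extend a basis K of D to a basis I of X ∪ D; then I − D is independent in S ∙ᶜ B.
    upper : ρ (X ∪ D) ≤ rank (sys S ∙ᶜ B) X + ρ D
    upper
      with K , K⊆D , K-indep , ∣K∣≡ρD ← rank-basis S D
      with I , K⊆I , I⊆X∪D , I-indep , ∣I∣≡ρX∪D ← basis-extension S K-indep (⊆-trans K⊆D (q⊆p∪q X D))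
      = begin
      ρ (X ∪ D)                  ≡⟨ sym ∣I∣≡ρX∪D ⟩
      ∣ I ∣                      ≡⟨ ∣p∣≡∣p∩q∣+∣p─q∣ I D ⟩
      ∣ I ∩ D ∣ + ∣ I ─ D ∣      ≤⟨ +-mono-≤ (indep⇒∣∣≤rank (sys S) (hereditary S I (I ∩ D) (p∩q⊆p I D) I-indep) (p∩q⊆q I D))
                                             (indep⇒∣∣≤rank (sys S ∙ᶜ B) I─D-indep I─D⊆X) ⟩
      ρ D + rank (sys S ∙ᶜ B) X  ≡⟨ +-comm (ρ D) _ ⟩
      rank (sys S ∙ᶜ B) X + ρ D  ∎
      where
      I─D⊆X : I ─ D ⊆ X
      I─D⊆X x∈ with x∈I , x∉D ← x∈p─q⁻ I D x∈ | x∈p∪q⁻ X D (I⊆X∪D x∈I)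
      ... | inj₁ x∈X = x∈X
      ... | inj₂ x∈D = contradiction x∈D x∉D
      I─D⊆E∩B : I ─ D ⊆ E ∩ B
      I─D⊆E∩B {x} x∈ with x∈I , x∉D ← x∈p─q⁻ I D x∈ | x ∈? B
      ... | yes x∈B = x∈p∩q⁺ (indep⊆ground S I I-indep x∈I , x∈B)
      ... | no  x∉B = contradiction (x∈p∧x∉q⇒x∈p─q (indep⊆ground S I I-indep x∈I) x∉B) x∉D
      I⊆I─D∪D : I ⊆ (I ─ D) ∪ D
      I⊆I─D∪D {x} x∈I with x ∈? D
      ... | yes x∈D = q⊆p∪q (I ─ D) D x∈D
      ... | no  x∉D = p⊆p∪q D (x∈p∧x∉q⇒x∈p─q x∈I x∉D)
      I─D-indep : Indep (sys S ∙ᶜ B) (I ─ D)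
      I─D-indep = indep-∙ᶜ⁺ I─D⊆E∩B (begin
        ∣ I ─ D ∣ + ρ D          ≡⟨ cong (∣ I ─ D ∣ +_) (sym ∣K∣≡ρD) ⟩
        ∣ I ─ D ∣ + ∣ K ∣        ≤⟨ +-monoʳ-≤ ∣ I ─ D ∣ (p⊆q⇒∣p∣≤∣q∣ (∩-greatest K⊆I K⊆D)) ⟩
        ∣ I ─ D ∣ + ∣ I ∩ D ∣    ≡⟨ +-comm ∣ I ─ D ∣ _ ⟩
        ∣ I ∩ D ∣ + ∣ I ─ D ∣    ≡⟨ sym (∣p∣≡∣p∩q∣+∣p─q∣ I D) ⟩
        ∣ I ∣                    ≤⟨ indep⇒∣∣≤rank (sys S) I-indep I⊆I─D∪D ⟩
        ρ ((I ─ D) ∪ D)          ∎)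

-- Closures and quotients

+-≤-telescope : ∀ {x₀ x₁ x₂ y₀ y₁ y₂} → x₀ + y₁ ≤ x₁ + y₀ → x₁ + y₂ ≤ x₂ + y₁ → x₀ + y₂ ≤ x₂ + y₀
+-≤-telescope {x₀} {x₁} {x₂} {y₀} {y₁} {y₂} step₀ step₁ =
  +-cancelʳ-≤ (x₁ + y₁) (x₀ + y₂) (x₂ + y₀)
    (subst₂ _≤_ (regroupˡ x₀ x₁ y₁ y₂) (regroupʳ x₁ x₂ y₀ y₁) (+-mono-≤ step₀ step₁))
  where
  regroupˡ : ∀ a b c d → (a + c) + (b + d) ≡ (a + d) + (b + c)
  regroupˡ = solve-∀
  regroupʳ : ∀ a b c d → (a + c) + (b + d) ≡ (b + c) + (a + d)
  regroupʳ = solve-∀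

module _ {n : ℕ} (S : Matroid n) where

  private
    E : Subset n
    E = ground (sys S)
    ρ : Subset n → ℕ
    ρ = rank (sys S)

  closure : Subset n → Subset n
  closure X = tabulate λ y → ⌊ y ∈? E ⌋ ∧ ⌊ ρ (X ∪ ⁅ y ⁆) ≟ ρ X ⌋

  ∈-closure⁻ : ∀ {X y} → y ∈ closure X → y ∈ E × ρ (X ∪ ⁅ y ⁆) ≡ ρ X
  ∈-closure⁻ {X} {y} y∈cl =
    let y∈E? , rank-eq? = ∧-true⁻ (trans (sym (lookup∘tabulate _ y)) ([]=⇒lookup y∈cl)) in
    ⌊⌋-true⁻ (y ∈? E) y∈E? , ⌊⌋-true⁻ (ρ (X ∪ ⁅ y ⁆) ≟ ρ X) rank-eq?

  ∈-closure⁺ : ∀ {X y} → y ∈ E → ρ (X ∪ ⁅ y ⁆) ≡ ρ X → y ∈ closure X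
  ∈-closure⁺ {X} {y} y∈E rank-eq = lookup⇒[]= y (closure X) (trans (lookup∘tabulate _ y)
    (∧-true⁺ (⌊⌋-true⁺ (y ∈? E) y∈E) (⌊⌋-true⁺ (ρ (X ∪ ⁅ y ⁆) ≟ ρ X) rank-eq)))

  ⊆-closure : ∀ {X} → X ⊆ E → X ⊆ closure X
  ⊆-closure {X} X⊆E x∈X = ∈-closure⁺ (X⊆E x∈X) (cong ρ (x∈p⇒p∪⁅x⁆≡p X x∈X))

  rank-closure : ∀ {X} → X ⊆ E → ρ (closure X) ≡ ρ X
  rank-closure {X} X⊆E = ≤-antisym ρcl≤ρX (rank-mono (sys S) (⊆-closure X⊆E))
    where
    ρcl≤ρX : ρ (closure X) ≤ ρ X
    ρcl≤ρX with J , J⊆X , J-indep , ∣J∣≡ρX ← rank-basis S X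
              | K , K⊆cl , K-indep , ∣K∣≡ρcl ← rank-basis S (closure X)
              | ∣ J ∣ <? ∣ K ∣
    ... | no ∣J∣≮∣K∣ = subst₂ _≤_ ∣K∣≡ρcl ∣J∣≡ρX (≮⇒≥ ∣J∣≮∣K∣)
    ... | yes ∣J∣<∣K∣ with y , y∈K , y∉J , J+y-indep ← augment S J K J-indep K-indep ∣J∣<∣K∣ =
      contradiction (begin-strict
        ρ X                 ≡⟨ sym ∣J∣≡ρX ⟩
        ∣ J ∣               <⟨ n<1+n ∣ J ∣ ⟩
        suc ∣ J ∣           ≡⟨ sym (x∉p⇒∣p∪⁅x⁆∣≡1+∣p∣ J y∉J) ⟩
        ∣ J ∪ ⁅ y ⁆ ∣       ≤⟨ indep⇒∣∣≤rank (sys S) J+y-indep (∪-monoˡ-⊆ ⁅ y ⁆ J⊆X) ⟩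
        ρ (X ∪ ⁅ y ⁆)       ≡⟨ proj₂ (∈-closure⁻ (K⊆cl y∈K)) ⟩
        ρ X                 ∎) (<-irrefl refl)
      where open ≤-Reasoning

  closure-isFlat : ∀ {X} → X ⊆ E → IsFlat (sys S) (closure X)
  closure-isFlat {X} X⊆E = (λ y∈cl → proj₁ (∈-closure⁻ y∈cl)) , increases
    where
    increases : ∀ y → y ∈ E → y ∉ closure X → ρ (closure X) < ρ (closure X ∪ ⁅ y ⁆)
    increases y y∈E y∉cl = begin-strict
      ρ (closure X)          ≡⟨ rank-closure X⊆E ⟩
      ρ X                    <⟨ ≤∧≢⇒< (rank-mono (sys S) (p⊆p∪q ⁅ y ⁆)) (λ eq → y∉cl (∈-closure⁺ y∈E (sym eq))) ⟩
      ρ (X ∪ ⁅ y ⁆)          ≤⟨ rank-mono (sys S) (∪-monoˡ-⊆ ⁅ y ⁆ (⊆-closure X⊆E)) ⟩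
      ρ (closure X ∪ ⁅ y ⁆)  ∎
      where open ≤-Reasoning

module _ {n : ℕ} {Q R : Matroid n} (Q⊴R : sys Q ⊴ sys R) where

  private
    E : Subset n
    E = ground (sys Q)
    ρQ ρR : Subset n → ℕ
    ρQ = rank (sys Q)
    ρR = rank (sys R)

  -- The closure of X in Q is a flat of Q avoiding e, hence a flat of R.
  quotient-rank-increase : ∀ {X} {e} → X ⊆ E → e ∈ E → ρQ X < ρQ (X ∪ ⁅ e ⁆) → ρR X < ρR (X ∪ ⁅ e ⁆)
  quotient-rank-increase {X} {e} X⊆E e∈E ρQ-increases =
    rank-increase-antitone R e (⊆-closure Q X⊆E) e∉cl
      (proj₂ (proj₂ Q⊴R _ (closure-isFlat Q X⊆E)) e (subst (e ∈_) (proj₁ Q⊴R) e∈E) e∉cl)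
    where
    e∉cl : e ∉ closure Q X
    e∉cl e∈cl = <-irrefl (sym (proj₂ (∈-closure⁻ Q e∈cl))) ρQ-increases

  quotient-rank-step : ∀ {X} {e} → X ⊆ E → e ∈ E → ρR X + ρQ (X ∪ ⁅ e ⁆) ≤ ρR (X ∪ ⁅ e ⁆) + ρQ X
  quotient-rank-step {X} {e} X⊆E e∈E with ρQ X <? ρQ (X ∪ ⁅ e ⁆)
  ... | no  ρQ-constant  = +-mono-≤ (rank-mono (sys R) (p⊆p∪q ⁅ e ⁆)) (≮⇒≥ ρQ-constant)
  ... | yes ρQ-increases = begin
    ρR X + ρQ (X ∪ ⁅ e ⁆)      ≤⟨ +-monoʳ-≤ (ρR X) (rank-∪⁅⁆≤1+rank Q X e) ⟩
    ρR X + suc (ρQ X)          ≡⟨ +-suc (ρR X) (ρQ X) ⟩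
    suc (ρR X) + ρQ X          ≤⟨ +-monoˡ-≤ (ρQ X) (quotient-rank-increase X⊆E e∈E ρQ-increases) ⟩
    ρR (X ∪ ⁅ e ⁆) + ρQ X      ∎
    where open ≤-Reasoning

  quotient-rank-inequality : ∀ {X Y} → X ⊆ Y → Y ⊆ E → ρR X + ρQ Y ≤ ρR Y + ρQ X
  quotient-rank-inequality {X₀} {Y} X₀⊆Y Y⊆E = go ∣ Y ─ X₀ ∣ X₀⊆Y ≤-refl
    where
    go : ∀ k {X} → X ⊆ Y → ∣ Y ─ X ∣ ≤ k → ρR X + ρQ Y ≤ ρR Y + ρQ X
    go k {X} X⊆Y _ with nonempty? (Y ─ X)
    ... | no Y─X-empty =
          subst (λ Z → ρR Z + ρQ Y ≤ ρR Y + ρQ Z) (sym (⊆-antisym X⊆Y (¬Nonempty[p─q]⇒p⊆q Y─X-empty))) ≤-refl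
    go zero    {X} _   ∣Y─X∣≤0 | yes (e , e∈Y─X) = contradiction (x∈p⇒∣p-x∣<∣p∣ e∈Y─X) (≤⇒≯ (≤-trans ∣Y─X∣≤0 z≤n))
    go (suc k) {X} X⊆Y ∣Y─X∣≤1+k | yes (e , e∈Y─X) with e∈Y , _ ← x∈p─q⁻ Y X e∈Y─X =
      +-≤-telescope {ρR X} {ρR (X ∪ ⁅ e ⁆)} {ρR Y} {ρQ X} {ρQ (X ∪ ⁅ e ⁆)} {ρQ Y}
                    (quotient-rank-step (⊆-trans X⊆Y Y⊆E) (Y⊆E e∈Y))
                    (go k (∪-least X⊆Y (x∈p⇒⁅x⁆⊆p e∈Y)) ∣Y─X+e∣≤k)
      where
      ∣Y─X+e∣≤k : ∣ Y ─ (X ∪ ⁅ e ⁆) ∣ ≤ k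
      ∣Y─X+e∣≤k = ≤-pred (begin-strict
        ∣ Y ─ (X ∪ ⁅ e ⁆) ∣   ≡⟨ cong ∣_∣ (sym (p─q─r≡p─q∪r Y X ⁅ e ⁆)) ⟩
        ∣ Y ─ X - e ∣         <⟨ x∈p⇒∣p-x∣<∣p∣ e∈Y─X ⟩
        ∣ Y ─ X ∣             ≤⟨ ∣Y─X∣≤1+k ⟩
        suc k                 ∎)
        where open ≤-Reasoning

  quotient⇒≤w : sys Q ≤w sys R
  quotient⇒≤w I I-indep = ∣∣≤rank⇒indep R (begin
    ∣ I ∣             ≤⟨ indep⇒∣∣≤rank (sys Q) I-indep ⊆-refl ⟩
    ρQ I              ≤⟨ m≤n+m _ _ ⟩
    ρR ⊥ + ρQ I       ≤⟨ quotient-rank-inequality (⊆-min I) (indep⊆ground Q I I-indep) ⟩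
    ρR I + ρQ ⊥       ≡⟨ cong (ρR I +_) (n≤0⇒n≡0 (subst (ρQ ⊥ ≤_) (∣⊥∣≡0 n) (rank≤∣∣ (sys Q) ⊥))) ⟩
    ρR I + 0          ≡⟨ +-identityʳ _ ⟩
    ρR I              ∎)
    where open ≤-Reasoning

-- Adjoining loops and isthmuses

module _ {n : ℕ} (S : Matroid n) (Y : Subset n) where

  private
    E : Subset n
    E = ground (sys S)

  indep-⊕loops : ∀ I → indep (sys S ⊕loops Y) I ≡ indep (sys S) I
  indep-⊕loops I = ≡true-ext (λ I-indep → proj₁ (∧-true⁻ I-indep))
    (λ I-indep → ∧-true⁺ I-indep (⌊⌋-true⁺ (I ⊆? E) (indep⊆ground S I I-indep)))

  ⊕loops-matroid : Matroid n
  ⊕loops-matroid = record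
    { sys          = sys S ⊕loops Y
    ; indep⊆ground = λ I I-indep → ⊆-trans (indep⊆ground S I (from I I-indep)) (p⊆p∪q Y)
    ; indep-empty  = to ⊥ (indep-empty S)
    ; hereditary   = λ I J J⊆I I-indep → to J (hereditary S I J J⊆I (from I I-indep))
    ; augment      = λ I J I-indep J-indep ∣I∣<∣J∣ →
        let x , x∈J , x∉I , I+x-indep = augment S I J (from I I-indep) (from J J-indep) ∣I∣<∣J∣
        in  x , x∈J , x∉I , to (I ∪ ⁅ x ⁆) I+x-indep
    }
    where
    from : ∀ I → Indep (sys S ⊕loops Y) I → Indep (sys S) I
    from I = subst (_≡ true) (indep-⊕loops I)
    to : ∀ I → Indep (sys S) I → Indep (sys S ⊕loops Y) I
    to I = subst (_≡ true) (sym (indep-⊕loops I))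

  rank-⊕loops : ∀ X → rank (sys S ⊕loops Y) X ≡ rank (sys S) X
  rank-⊕loops = indep-cong⇒rank≡ {S = sys S ⊕loops Y} {T = sys S} indep-⊕loops

  indep-⊕isthmuses⁻ : ∀ {I} → Indep (sys S ⊕isthmuses Y) I → Indep (sys S) (I ∩ E) × I ⊆ E ∪ Y
  indep-⊕isthmuses⁻ {I} I-indep = let I∩E-indep , I⊆E∪Y? = ∧-true⁻ I-indep in
    I∩E-indep , ⌊⌋-true⁻ (I ⊆? E ∪ Y) I⊆E∪Y?

  indep-⊕isthmuses⁺ : ∀ {I} → Indep (sys S) (I ∩ E) → I ⊆ E ∪ Y → Indep (sys S ⊕isthmuses Y) I
  indep-⊕isthmuses⁺ {I} I∩E-indep I⊆E∪Y = ∧-true⁺ I∩E-indep (⌊⌋-true⁺ (I ⊆? E ∪ Y) I⊆E∪Y)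

  private
    [p∪⁅x⁆]∩E⊆p∩E∪⁅x⁆ : ∀ p x → (p ∪ ⁅ x ⁆) ∩ E ⊆ p ∩ E ∪ ⁅ x ⁆
    [p∪⁅x⁆]∩E⊆p∩E∪⁅x⁆ p x y∈ with y∈p+x , y∈E ← x∈p∩q⁻ (p ∪ ⁅ x ⁆) E y∈ | x∈p∪q⁻ p ⁅ x ⁆ y∈p+x
    ... | inj₁ y∈p   = p⊆p∪q ⁅ x ⁆ (x∈p∩q⁺ (y∈p , y∈E))
    ... | inj₂ y∈⁅x⁆ = q⊆p∪q (p ∩ E) ⁅ x ⁆ y∈⁅x⁆

    x∉E⇒[p∪⁅x⁆]∩E⊆p∩E : ∀ p {x} → x ∉ E → (p ∪ ⁅ x ⁆) ∩ E ⊆ p ∩ E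
    x∉E⇒[p∪⁅x⁆]∩E⊆p∩E p {x} x∉E y∈ with x∈p∪q⁻ (p ∩ E) ⁅ x ⁆ ([p∪⁅x⁆]∩E⊆p∩E∪⁅x⁆ p x y∈)
    ... | inj₁ y∈p∩E = y∈p∩E
    ... | inj₂ y∈⁅x⁆ rewrite x∈⁅y⁆⇒x≡y x y∈⁅x⁆ = contradiction (proj₂ (x∈p∩q⁻ (p ∪ ⁅ x ⁆) E y∈)) x∉E

  -- Either I ∩ E can be augmented inside S, or J has more isthmuses than I.
  ⊕isthmuses-augment : ∀ I J → Indep (sys S ⊕isthmuses Y) I → Indep (sys S ⊕isthmuses Y) J → ∣ I ∣ < ∣ J ∣ →
                       ∃ λ x → x ∈ J × x ∉ I × Indep (sys S ⊕isthmuses Y) (I ∪ ⁅ x ⁆)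
  ⊕isthmuses-augment I J I-indep J-indep ∣I∣<∣J∣
    with I∩E-indep , I⊆E∪Y ← indep-⊕isthmuses⁻ I-indep
       | J∩E-indep , J⊆E∪Y ← indep-⊕isthmuses⁻ J-indep
       | ∣ I ∩ E ∣ <? ∣ J ∩ E ∣
  ... | yes ∣I∩E∣<∣J∩E∣
      with x , x∈J∩E , x∉I∩E , I∩E+x-indep ← augment S (I ∩ E) (J ∩ E) I∩E-indep J∩E-indep ∣I∩E∣<∣J∩E∣
      with x∈J , x∈E ← x∈p∩q⁻ J E x∈J∩E
      = x , x∈J , (λ x∈I → x∉I∩E (x∈p∩q⁺ (x∈I , x∈E)))
      , indep-⊕isthmuses⁺ (hereditary S _ _ ([p∪⁅x⁆]∩E⊆p∩E∪⁅x⁆ I x) I∩E+x-indep)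
                          (∪-least I⊆E∪Y (x∈p⇒⁅x⁆⊆p (J⊆E∪Y x∈J)))
  ... | no ∣I∩E∣≮∣J∩E∣
      with x , x∈J─E , x∉I─E ← ∣p∣<∣q∣⇒∃∈q─p (∣p─r∣<∣q─r∣ I J E ∣I∣<∣J∣ (≮⇒≥ ∣I∩E∣≮∣J∩E∣))
      with x∈J , x∉E ← x∈p─q⁻ J E x∈J─E
      = x , x∈J , (λ x∈I → x∉I─E (x∈p∧x∉q⇒x∈p─q x∈I x∉E))
      , indep-⊕isthmuses⁺ (hereditary S _ _ (x∉E⇒[p∪⁅x⁆]∩E⊆p∩E I x∉E) I∩E-indep)
                          (∪-least I⊆E∪Y (x∈p⇒⁅x⁆⊆p (J⊆E∪Y x∈J)))

  ⊕isthmuses-matroid : Matroid n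
  ⊕isthmuses-matroid = record
    { sys          = sys S ⊕isthmuses Y
    ; indep⊆ground = λ I I-indep → proj₂ (indep-⊕isthmuses⁻ I-indep)
    ; indep-empty  = indep-⊕isthmuses⁺ (hereditary S ⊥ (⊥ ∩ E) (p∩q⊆p ⊥ E) (indep-empty S)) (⊆-min (E ∪ Y))
    ; hereditary   = λ I J J⊆I I-indep → let I∩E-indep , I⊆E∪Y = indep-⊕isthmuses⁻ I-indep in
        indep-⊕isthmuses⁺ (hereditary S (I ∩ E) (J ∩ E) (∩-monoˡ-⊆ E J⊆I) I∩E-indep)
                          (⊆-trans J⊆I I⊆E∪Y)
    ; augment      = ⊕isthmuses-augment
    }

  rank-⊕isthmuses : ∀ {X} → X ⊆ E ∪ Y → rank (sys S ⊕isthmuses Y) X ≡ rank (sys S) (X ∩ E) + ∣ X ─ E ∣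
  rank-⊕isthmuses {X} X⊆E∪Y = ≤-antisym upper lower
    where
    open ≤-Reasoning
    upper : rank (sys S ⊕isthmuses Y) X ≤ rank (sys S) (X ∩ E) + ∣ X ─ E ∣
    upper with I , I⊆X , I-indep , ∣I∣≡rank ← rank-basis ⊕isthmuses-matroid X = begin
      rank (sys S ⊕isthmuses Y) X    ≡⟨ sym ∣I∣≡rank ⟩
      ∣ I ∣                          ≡⟨ ∣p∣≡∣p∩q∣+∣p─q∣ I E ⟩
      ∣ I ∩ E ∣ + ∣ I ─ E ∣          ≤⟨ +-mono-≤ (indep⇒∣∣≤rank (sys S) (proj₁ (indep-⊕isthmuses⁻ I-indep)) (∩-monoˡ-⊆ E I⊆X))
                                                 (p⊆q⇒∣p∣≤∣q∣ (─-monoˡ-⊆ E I⊆X)) ⟩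
      rank (sys S) (X ∩ E) + ∣ X ─ E ∣ ∎
    lower : rank (sys S) (X ∩ E) + ∣ X ─ E ∣ ≤ rank (sys S ⊕isthmuses Y) X
    lower with J , J⊆X∩E , J-indep , ∣J∣≡rank ← rank-basis S (X ∩ E) = begin
      rank (sys S) (X ∩ E) + ∣ X ─ E ∣  ≡⟨ cong (_+ ∣ X ─ E ∣) (sym ∣J∣≡rank) ⟩
      ∣ J ∣ + ∣ X ─ E ∣                 ≡⟨ sym (Empty[p∩q]⇒∣p∪q∣≡∣p∣+∣q∣ J (X ─ E) disjoint) ⟩
      ∣ J ∪ (X ─ E) ∣                   ≤⟨ indep⇒∣∣≤rank (sys S ⊕isthmuses Y) J∪[X─E]-indep (∪-least (⊆-trans J⊆X∩E (p∩q⊆p X E)) (p─q⊆p X E)) ⟩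
      rank (sys S ⊕isthmuses Y) X       ∎
      where
      J⊆E : J ⊆ E
      J⊆E = ⊆-trans J⊆X∩E (p∩q⊆q X E)
      disjoint : Empty (J ∩ (X ─ E))
      disjoint (x , x∈) = let x∈J , x∈X─E = x∈p∩q⁻ J (X ─ E) x∈ in x∈p─q⇒x∉q X E x∈X─E (J⊆E x∈J)
      [J∪X─E]∩E⊆J : (J ∪ (X ─ E)) ∩ E ⊆ J
      [J∪X─E]∩E⊆J x∈ with x∈J∪X─E , x∈E ← x∈p∩q⁻ (J ∪ (X ─ E)) E x∈ | x∈p∪q⁻ J (X ─ E) x∈J∪X─E
      ... | inj₁ x∈J   = x∈J
      ... | inj₂ x∈X─E = contradiction x∈E (x∈p─q⇒x∉q X E x∈X─E)
      J∪[X─E]-indep : Indep (sys S ⊕isthmuses Y) (J ∪ (X ─ E))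
      J∪[X─E]-indep = indep-⊕isthmuses⁺ (hereditary S J _ [J∪X─E]∩E⊆J J-indep)
                  (∪-least (⊆-trans J⊆E (p⊆p∪q Y)) (⊆-trans (p─q⊆p X E) X⊆E∪Y))

-- Splices

module _ {n : ℕ} (M N : Matroid n) where

  private
    A B : Subset n
    A = ground (sys M)
    B = ground (sys N)
    M₁ N₀ : Matroid n
    M₁ = ⊕isthmuses-matroid M (B ─ A)
    N₀ = ⊕loops-matroid N (A ─ B)
    ρM ρN : Subset n → ℕ
    ρM = rank (sys M)
    ρN = rank (sys N)

  rank-from-restriction : (L : Matroid n) → (sys L ∣ʳ A) ≅ sys M → ∀ {X} → X ⊆ A → rank (sys L) X ≡ ρM X
  rank-from-restriction L L∣A≅M X⊆A = trans (sym (rank-∣ʳ (sys L) X⊆A)) (≅⇒rank≡ L∣A≅M _)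

  module _ (L : Matroid n) (L-ground : ground (sys L) ≡ A ∪ B) where

    private
      ρL : Subset n → ℕ
      ρL = rank (sys L)

    ground─B : ground (sys L) ─ B ≡ A ─ B
    ground─B = trans (cong (_─ B) L-ground) ([p∪q]─q≡p─q A B)

    rank-from-contraction : (sys L ∙ᶜ B) ≅ sys N → ∀ X → ρN X + ρL (A ─ B) ≡ ρL (X ∪ (A ─ B))
    rank-from-contraction L∙B≅N X = begin
      ρN X + ρL (A ─ B)                         ≡⟨ cong₂ _+_ (sym (≅⇒rank≡ L∙B≅N X)) (cong ρL (sym ground─B)) ⟩
      rank (sys L ∙ᶜ B) X + ρL (ground (sys L) ─ B) ≡⟨ rank-∙ᶜ L B X ⟩
      ρL (X ∪ (ground (sys L) ─ B))             ≡⟨ cong (λ D → ρL (X ∪ D)) ground─B ⟩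
      ρL (X ∪ (A ─ B))                          ∎
      where open ≡-Reasoning

    indep-∙B⁻ : ∀ {I} → Indep (sys L ∙ᶜ B) I → I ⊆ B × ρL (I ∪ (A ─ B)) ≡ ∣ I ∣ + ρL (A ─ B)
    indep-∙B⁻ {I} I-indep = let I⊆E∩B , rank-eq = indep-∙ᶜ⁻ L B I-indep in
      ⊆-trans I⊆E∩B (p∩q⊆q _ B) , subst (λ D → ρL (I ∪ D) ≡ ∣ I ∣ + ρL D) ground─B rank-eq

    indep-∙B⁺ : ∀ {I} → I ⊆ B → ∣ I ∣ + ρL (A ─ B) ≤ ρL (I ∪ (A ─ B)) → Indep (sys L ∙ᶜ B) I
    indep-∙B⁺ {I} I⊆B rank-ineq = indep-∙ᶜ⁺ L B
      (∩-greatest (⊆-trans I⊆B (subst (B ⊆_) (sym L-ground) (q⊆p∪q A B))) I⊆B)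
      (subst (λ D → ∣ I ∣ + ρL D ≤ ρL (I ∪ D)) (sym ground─B) rank-ineq)

  splice-rank : (L : Matroid n) → IsSplice (sys M) (sys N) (sys L) → r (sys L) ≡ r (sys N) + ρM (A ─ B)
  splice-rank L (L-ground , L∣A≅M , L∙B≅N) = begin
    rank (sys L) (ground (sys L))   ≡⟨ cong (rank (sys L)) (trans L-ground (sym (q∪[p─q]≡p∪q A B))) ⟩
    rank (sys L) (B ∪ (A ─ B))      ≡⟨ sym (rank-from-contraction L L-ground L∙B≅N B) ⟩
    ρN B + rank (sys L) (A ─ B)     ≡⟨ cong (ρN B +_) (rank-from-restriction L L∣A≅M (p─q⊆p A B)) ⟩
    r (sys N) + ρM (A ─ B)          ∎
    where open ≡-Reasoning

  N₀⊴splice : (L : Matroid n) → IsSplice (sys M) (sys N) (sys L) → sys N₀ ⊴ sys L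
  N₀⊴splice L (L-ground , _ , L∙B≅N) = ground-eq , flat
    where
    ρL : Subset n → ℕ
    ρL = rank (sys L)
    ground-eq : B ∪ (A ─ B) ≡ ground (sys L)
    ground-eq = trans (q∪[p─q]≡p∪q A B) (sym L-ground)
    ρL≡ρN+ : ∀ {X} → A ─ B ⊆ X → ρL X ≡ ρN X + ρL (A ─ B)
    ρL≡ρN+ {X} A─B⊆X = trans (cong ρL (sym (⊆-antisym (∪-least ⊆-refl A─B⊆X) (p⊆p∪q _))))
                              (sym (rank-from-contraction L L-ground L∙B≅N X))
    flat : ∀ F → IsFlat (sys N₀) F → IsFlat (sys L) F
    flat F (F⊆E , F-closed) = subst (F ⊆_) ground-eq F⊆E , increases
      where
      A─B⊆F : A ─ B ⊆ F
      A─B⊆F {x} x∈A─B with x ∈? F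
      ... | yes x∈F = x∈F
      ... | no  x∉F = contradiction (F-closed x (q⊆p∪q B (A ─ B) x∈A─B) x∉F) (<-irrefl loop-rank)
        where
        loop-rank : rank (sys N₀) F ≡ rank (sys N₀) (F ∪ ⁅ x ⁆)
        loop-rank = begin
          rank (sys N₀) F           ≡⟨ rank-⊕loops N (A ─ B) F ⟩
          ρN F                      ≡⟨ sym (rank-∪-outside N F ⁅ x ⁆ λ y∈⁅x⁆ → subst (_∉ B) (sym (x∈⁅y⁆⇒x≡y x y∈⁅x⁆)) (x∈p─q⇒x∉q A B x∈A─B)) ⟩
          ρN (F ∪ ⁅ x ⁆)            ≡⟨ sym (rank-⊕loops N (A ─ B) (F ∪ ⁅ x ⁆)) ⟩
          rank (sys N₀) (F ∪ ⁅ x ⁆) ∎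
          where open ≡-Reasoning
      increases : ∀ e → e ∈ ground (sys L) → e ∉ F → ρL F < ρL (F ∪ ⁅ e ⁆)
      increases e e∈E e∉F with e ∈? B
      ... | no  e∉B = contradiction (A─B⊆F (subst (e ∈_) (ground─B L L-ground) (x∈p∧x∉q⇒x∈p─q e∈E e∉B))) e∉F
      ... | yes e∈B = subst₂ _<_ (sym (ρL≡ρN+ A─B⊆F)) (sym (ρL≡ρN+ (⊆-trans A─B⊆F (p⊆p∪q ⁅ e ⁆))))
                        (+-monoˡ-< (ρL (A ─ B)) (subst₂ _<_ (rank-⊕loops N (A ─ B) F) (rank-⊕loops N (A ─ B) (F ∪ ⁅ e ⁆))
                                                              (F-closed e (p⊆p∪q (A ─ B) e∈B) e∉F)))

  -- Read through ρ_{M₁}(X) = ρ_M(X ∩ A) + |X − A|: an element of A raises the first summand, any other the second.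
  splice⊴M₁ : (L : Matroid n) → IsSplice (sys M) (sys N) (sys L) → sys L ⊴ sys M₁
  splice⊴M₁ L (L-ground , L∣A≅M , _) = ground-eq , flat
    where
    ground-eq : ground (sys L) ≡ A ∪ (B ─ A)
    ground-eq = trans L-ground (sym (trans (q∪[p─q]≡p∪q B A) (∪-comm B A)))
    flat : ∀ F → IsFlat (sys L) F → IsFlat (sys M₁) F
    flat F (F⊆E , F-closed) = F⊆G , increases
      where
      F⊆G : F ⊆ A ∪ (B ─ A)
      F⊆G = subst (F ⊆_) ground-eq F⊆E
      increases : ∀ e → e ∈ A ∪ (B ─ A) → e ∉ F → rank (sys M₁) F < rank (sys M₁) (F ∪ ⁅ e ⁆)
      increases e e∈G e∉F = subst₂ _<_
        (sym (rank-⊕isthmuses M (B ─ A) F⊆G)) (sym (rank-⊕isthmuses M (B ─ A) (∪-least F⊆G (x∈p⇒⁅x⁆⊆p e∈G))))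
        split
        where
        F⊆F+e : F ⊆ F ∪ ⁅ e ⁆
        F⊆F+e = p⊆p∪q ⁅ e ⁆
        split : ρM (F ∩ A) + ∣ F ─ A ∣ < ρM ((F ∪ ⁅ e ⁆) ∩ A) + ∣ (F ∪ ⁅ e ⁆) ─ A ∣
        split with e ∈? A
        ... | yes e∈A = +-mono-<-≤ (begin-strict
          ρM (F ∩ A)                ≡⟨ sym (rank-from-restriction L L∣A≅M (p∩q⊆q F A)) ⟩
          rank (sys L) (F ∩ A)      <⟨ rank-increase-antitone L e (p∩q⊆p F A) e∉F
                                         (F-closed e (subst (e ∈_) (sym ground-eq) e∈G) e∉F) ⟩
          rank (sys L) (F ∩ A ∪ ⁅ e ⁆) ≡⟨ rank-from-restriction L L∣A≅M F∩A+e⊆A ⟩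
          ρM (F ∩ A ∪ ⁅ e ⁆)        ≤⟨ rank-mono (sys M) (∩-greatest (∪-monoˡ-⊆ ⁅ e ⁆ (p∩q⊆p F A)) F∩A+e⊆A) ⟩
          ρM ((F ∪ ⁅ e ⁆) ∩ A)      ∎)
          (p⊆q⇒∣p∣≤∣q∣ (─-monoˡ-⊆ A F⊆F+e))
          where
          open ≤-Reasoning
          F∩A+e⊆A : F ∩ A ∪ ⁅ e ⁆ ⊆ A
          F∩A+e⊆A = ∪-least (p∩q⊆q F A) (x∈p⇒⁅x⁆⊆p e∈A)
        ... | no e∉A = +-mono-≤-< (rank-mono (sys M) (∩-monoˡ-⊆ A F⊆F+e))
          (p⊂q⇒∣p∣<∣q∣ (─-monoˡ-⊆ A F⊆F+e , e , x∈p∧x∉q⇒x∈p─q (q⊆p∪q F ⁅ e ⁆ (x∈⁅x⁆ e)) e∉A ,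
                        λ e∈F─A → e∉F (p─q⊆p F A e∈F─A)))

  splice∈𝓛 : (L : Matroid n) → IsSplice (sys M) (sys N) (sys L) → InCalL (sys M) (sys N) (sys L)
  splice∈𝓛 L splice = proj₁ splice , N₀⊴splice L splice , splice⊴M₁ L splice , splice-rank L splice

  restriction-above-splice : (L P : Matroid n) → IsSplice (sys M) (sys N) (sys L) → ground (sys P) ≡ A ∪ B →
                             sys P ⊴ sys M₁ → sys L ≤w sys P → (sys P ∣ʳ A) ≅ sys M
  restriction-above-splice L P (_ , L∣A≅M , _) P-ground P⊴M₁ L≤P =
    trans (cong (_∩ A) P-ground) (trans (∩-comm (A ∪ B) A) (∩-abs-∪ A B)) ,
    λ I → ≡true-ext (P⇒M I) (M⇒P I)
    where
    P⇒M : ∀ I → Indep (sys P ∣ʳ A) I → Indep (sys M) I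
    P⇒M I I-indep = let I-indepP , I⊆A? = ∧-true⁻ I-indep in
      hereditary M (I ∩ A) I (∩-greatest ⊆-refl (⌊⌋-true⁻ (I ⊆? A) I⊆A?))
        (proj₁ (indep-⊕isthmuses⁻ M (B ─ A) (quotient⇒≤w {Q = P} {R = M₁} P⊴M₁ I I-indepP)))
    M⇒P : ∀ I → Indep (sys M) I → Indep (sys P ∣ʳ A) I
    M⇒P I I-indep = let I-indepL , I⊆A? = ∧-true⁻ (trans (proj₂ L∣A≅M I) I-indep) in
      ∧-true⁺ (L≤P I I-indepL) I⊆A?

  contraction-above-splice : (L P : Matroid n) → IsSplice (sys M) (sys N) (sys L) → InCalL (sys M) (sys N) (sys P) →
                             (sys P ∣ʳ A) ≅ sys M → sys L ≤w sys P → (sys P ∙ᶜ B) ≅ sys N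
  contraction-above-splice L P (L-ground , L∣A≅M , L∙B≅N) (P-ground , N₀⊴P , _ , P-rank) P∣A≅M L≤P =
    trans (cong (_∩ B) P-ground) (trans (∩-comm (A ∪ B) B) (trans (cong (B ∩_) (∪-comm A B)) (∩-abs-∪ B A))) ,
    λ I → ≡true-ext (P⇒N I) (N⇒P I)
    where
    ρL ρP : Subset n → ℕ
    ρL = rank (sys L)
    ρP = rank (sys P)
    ρP[A─B] : ρP (A ─ B) ≡ ρM (A ─ B)
    ρP[A─B] = rank-from-restriction P P∣A≅M (p─q⊆p A B)
    ρN[X∪A─B] : ∀ X → ρN (X ∪ (A ─ B)) ≡ ρN X
    ρN[X∪A─B] X = rank-∪-outside N X (A ─ B) (x∈p─q⇒x∉q A B)
    N⇒P : ∀ I → Indep (sys N) I → Indep (sys P ∙ᶜ B) I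
    N⇒P I I-indep with I⊆B , rank-eq ← indep-∙B⁻ L L-ground (trans (proj₂ L∙B≅N I) I-indep) =
      indep-∙B⁺ P P-ground I⊆B (begin
        ∣ I ∣ + ρP (A ─ B)       ≡⟨ cong (∣ I ∣ +_) (trans ρP[A─B] (sym (rank-from-restriction L L∣A≅M (p─q⊆p A B)))) ⟩
        ∣ I ∣ + ρL (A ─ B)       ≡⟨ sym rank-eq ⟩
        ρL (I ∪ (A ─ B))         ≤⟨ rank-mono-≤w {S = sys L} {T = sys P} L≤P (I ∪ (A ─ B)) ⟩
        ρP (I ∪ (A ─ B))         ∎)
      where open ≤-Reasoning
    P⇒N : ∀ I → Indep (sys P ∙ᶜ B) I → Indep (sys N) I
    P⇒N I I-indep with I⊆B , rank-eq ← indep-∙B⁻ P P-ground I-indep =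
      ∣∣≤rank⇒indep N (cancel ∣ I ∣ (ρM (A ─ B)) (r (sys N)) (ρN I) (begin
        (∣ I ∣ + ρM (A ─ B)) + r (sys N)                  ≡⟨ cong₂ _+_ (trans (cong (∣ I ∣ +_) (sym ρP[A─B])) (sym rank-eq))
                                                                       (sym (trans (rank-⊕loops N (A ─ B) E₀) (ρN[X∪A─B] B))) ⟩
        ρP (I ∪ (A ─ B)) + rank (sys N₀) E₀               ≤⟨ quotient-rank-inequality {Q = N₀} {R = P} N₀⊴P (∪-least (⊆-trans I⊆B (p⊆p∪q (A ─ B))) (q⊆p∪q B (A ─ B))) ⊆-refl ⟩
        ρP E₀ + rank (sys N₀) (I ∪ (A ─ B))               ≡⟨ cong₂ _+_ (trans (cong ρP (proj₁ N₀⊴P)) P-rank)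
                                                                       (trans (rank-⊕loops N (A ─ B) _) (ρN[X∪A─B] I)) ⟩
        (r (sys N) + ρM (A ─ B)) + ρN I                   ∎))
      where
      open ≤-Reasoning
      E₀ : Subset n
      E₀ = B ∪ (A ─ B)
      cancel : ∀ a m r b → (a + m) + r ≤ (r + m) + b → a ≤ b
      cancel a m r b = +-cancelʳ-≤ (m + r) a b ∘ subst₂ _≤_ (+-assoc a m r) (regroup r m b)
        where
        regroup : ∀ r m b → (r + m) + b ≡ b + (m + r)
        regroup = solve-∀

  splice-upward-closed : (L P : Matroid n) → InCalL (sys M) (sys N) (sys P) → IsSplice (sys M) (sys N) (sys L) →
                         sys L ≤w sys P → IsSplice (sys M) (sys N) (sys P)
  splice-upward-closed L P P∈𝓛@(P-ground , _ , P⊴M₁ , _) L-splice L≤P =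
    P-ground , P∣A≅M , contraction-above-splice L P L-splice P∈𝓛 P∣A≅M L≤P
    where
    P∣A≅M : (sys P ∣ʳ A) ≅ sys M
    P∣A≅M = restriction-above-splice L P L-splice P-ground P⊴M₁ L≤P

-- Matchedness only guarantees that splices exist; neither part of the proposition uses it.
proposition3p2 : ∀ {n : ℕ} (M N : Matroid n) → Matched (sys M) (sys N) →
    ((L : Matroid n) → IsSplice (sys M) (sys N) (sys L) → InCalL (sys M) (sys N) (sys L))
    × ((L P : Matroid n) → InCalL (sys M) (sys N) (sys L) → InCalL (sys M) (sys N) (sys P) →
        IsSplice (sys M) (sys N) (sys L) → sys L ≤w sys P → IsSplice (sys M) (sys N) (sys P))
proposition3p2 M N _ = splice∈𝓛 M N , λ L P _ → splice-upward-closed M N L P
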